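{- Let $q>2$ be an odd integer. Then for every integer $n\ge1$, $f_{2,q}(n+1)\ge f_{2,q}(n)$.
   Context: $\mathbb{N}$ denotes the set of nonnegative integers. For an odd integer $q>2$, $f_{2,q}(n)$ denotes the number of different expressions of the positive integer $n$ as a sum of distinct terms taken from $\{2^{\alpha}q^{\beta}:\alpha,\beta\in\mathbb{N}\}$ (i.e. the number of finite subsets of this set whose elements sum to $n$). -}

module Defs where

open import Data.Nat using (ℕ; zero; suc; _+_; _*_; _^_; _≡ᵇ_)
open import Data.Bool using (Bool; true; false; _∧_)
open import Data.List using (List; []; _∷_; _++_; map; length; upTo; filterᵇ)
open import Data.Bool.ListAction using (any)
open import Data.Nat.ListAction using (sum)

-- The set T_q = { 2^α q^β : α, β ∈ ℕ }.
-- isTermᵇ q n m decides whether m = 2^α * q^β for some α, β ≤ n.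
-- For 1 ≤ m ≤ n this is exactly membership of m in T_q, since
-- 2^α * q^β = m ≤ n forces α < 2^α ≤ n and β < q^β ≤ n (q ≥ 2).
isTermᵇ : ℕ → ℕ → ℕ → Bool
isTermᵇ q n m = any (λ a → any (λ b → (2 ^ a) * (q ^ b) ≡ᵇ m) (upTo (suc n))) (upTo (suc n))

termsUpTo : ℕ → ℕ → List ℕ
termsUpTo q n = filterᵇ (isTermᵇ q n) (map suc (upTo n))

-- All sublists (= subsets, as the input has no duplicates) of a list.
subsets : List ℕ → List (List ℕ)
subsets []       = [] ∷ []
subsets (x ∷ xs) = subsets xs ++ map (x ∷_) (subsets xs)

-- f_{2,q}(n): number of finite subsets of T_q whose elements sum to n.
-- Any such subset consists of elements ≤ n, so it is a subset of termsUpTo q n.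
f₂ : ℕ → ℕ → ℕ
f₂ q n = length (filterᵇ (λ s → sum s ≡ᵇ n) (subsets (termsUpTo q n)))

{-# OPTIONS --safe #-}
-- Only the powers of two among the terms matter. Choose k
-- with 2^k ≤ n+1 < 2^(k+1) and split the terms ≤ n+1 into 1, 2, …, 2^k and a rest R. Since
-- (1 − X) ∏_{j≤k} (1 + X^(2^j)) = 1 − X^(2^(k+1)), the generating series F of subset sums of the
-- terms ≤ n+1 and G of those of R satisfy (1 − X) F = (1 − X^(2^(k+1))) G, and comparing the
-- coefficients of X^(n+1) gives F(n+1) − F(n) = G(n+1) ≥ 0. Finally f(n) ≤ F(n) and f(n+1) = F(n+1).
module Submission where

open import Defs
open import Data.Nat using (ℕ; zero; suc; _+_; _*_; _^_; _≡ᵇ_; _≤_; _<_; z≤n; s≤s)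
open import Data.Nat.Properties
open import Data.Nat.Divisibility using (_∣_)
open import Data.Nat.ListAction using (sum)
open import Data.Bool.ListAction using (any)
open import Data.Bool using (Bool; true; false; T)
open import Data.List using (List; []; _∷_; _++_; [_]; map; length; upTo; filterᵇ)
open import Data.List.Properties using (length-++; filter-++; filter-none; upTo-∷ʳ)
open import Data.List.Membership.Propositional using (_∈_; lose)
open import Data.List.Membership.Propositional.Properties using (∈-∃++; ∈-map⁺; ∈-upTo⁺; ∈-filter⁺)
open import Data.List.Relation.Unary.All using (universal)
open import Data.List.Relation.Unary.Any using (Any; here; there)
import Data.List.Relation.Unary.Any as Any
open import Data.List.Relation.Unary.Any.Properties using (any⁺; any⁻)
open import Data.List.Relation.Binary.Permutation.Propositional using (_↭_; refl; prep; swap)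
  renaming (trans to ↭-trans)
open import Data.List.Relation.Binary.Permutation.Propositional.Properties using (∈-resp-↭)
  renaming (shift to ↭-shift)
open import Data.List.Relation.Binary.Sublist.Propositional using (_⊆_; []; _∷_; _∷ʳ_; ⊆-refl)
open import Data.List.Relation.Binary.Sublist.Propositional.Properties using (Any-resp-⊆; map⁺; filter⁺; ++⁺ʳ)
open import Data.Product using (_×_; _,_; ∃-syntax)
open import Data.Sum using (inj₁; inj₂)
open import Function using (_∘_)
open import Relation.Nullary using (¬_; contradiction)
open import Relation.Nullary.Decidable using (T?)
open import Relation.Binary.PropositionalEquality
  using (_≡_; refl; _≗_; cong; cong₂; sym; trans; subst; module ≡-Reasoning)
open import Algebra.Properties.CommutativeSemigroup +-commutativeSemigroup
  using (interchange; x∙yz≈xz∙y; xy∙z≈xz∙y)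

private
  variable
    A B : Set

-- shift x f is the series f multiplied by X^x.
shift : ℕ → (ℕ → ℕ) → ℕ → ℕ
shift zero    f t       = f t
shift (suc x) f zero    = 0
shift (suc x) f (suc t) = shift x f t

shift-cong : ∀ x {f g} → f ≗ g → shift x f ≗ shift x g
shift-cong zero    f≗g t       = f≗g t
shift-cong (suc x) f≗g zero    = refl
shift-cong (suc x) f≗g (suc t) = shift-cong x f≗g t

shift-mono-≤ : ∀ x {f g} → (∀ t → f t ≤ g t) → ∀ t → shift x f t ≤ shift x g t
shift-mono-≤ zero    f≤g t       = f≤g t
shift-mono-≤ (suc x) f≤g zero    = z≤n
shift-mono-≤ (suc x) f≤g (suc t) = shift-mono-≤ x f≤g t

shift-+ : ∀ x y f → shift x (shift y f) ≗ shift (x + y) f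
shift-+ zero    y f t       = refl
shift-+ (suc x) y f zero    = refl
shift-+ (suc x) y f (suc t) = shift-+ x y f t

shift-comm : ∀ x y f → shift x (shift y f) ≗ shift y (shift x f)
shift-comm x y f t = begin
  shift x (shift y f) t ≡⟨ shift-+ x y f t ⟩
  shift (x + y) f t     ≡⟨ cong (λ z → shift z f t) (+-comm x y) ⟩
  shift (y + x) f t     ≡⟨ shift-+ y x f t ⟨
  shift y (shift x f) t ∎
  where open ≡-Reasoning

shift-distrib-+ : ∀ x f g t → shift x (λ u → f u + g u) t ≡ shift x f t + shift x g t
shift-distrib-+ zero    f g t       = refl
shift-distrib-+ (suc x) f g zero    = refl
shift-distrib-+ (suc x) f g (suc t) = shift-distrib-+ x f g t

shift-< : ∀ x f {t} → t < x → shift x f t ≡ 0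
shift-< (suc x) f {zero}  _         = refl
shift-< (suc x) f {suc t} (s≤s t<x) = shift-< x f t<x

-- ways xs t is the coefficient of X^t in ∏_{x ∈ xs} (1 + X^x).
ways : List ℕ → ℕ → ℕ
ways []       zero    = 1
ways []       (suc _) = 0
ways (x ∷ xs) t       = ways xs t + shift x (ways xs) t

ways-∷-cong : ∀ x {xs ys} → ways xs ≗ ways ys → ways (x ∷ xs) ≗ ways (x ∷ ys)
ways-∷-cong x eq t = cong₂ _+_ (eq t) (shift-cong x eq t)

ways-swap : ∀ x y zs → ways (x ∷ y ∷ zs) ≗ ways (y ∷ x ∷ zs)
ways-swap x y zs t = begin
  (w t + shift y w t) + shift x (λ u → w u + shift y w u) t
    ≡⟨ cong (w t + shift y w t +_) (shift-distrib-+ x w (shift y w) t) ⟩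
  (w t + shift y w t) + (shift x w t + shift x (shift y w) t)
    ≡⟨ interchange (w t) _ _ _ ⟩
  (w t + shift x w t) + (shift y w t + shift x (shift y w) t)
    ≡⟨ cong (λ z → w t + shift x w t + (shift y w t + z)) (shift-comm x y w t) ⟩
  (w t + shift x w t) + (shift y w t + shift y (shift x w) t)
    ≡⟨ cong (w t + shift x w t +_) (shift-distrib-+ y w (shift x w) t) ⟨
  (w t + shift x w t) + shift y (λ u → w u + shift x w u) t ∎
  where
  open ≡-Reasoning
  w : ℕ → ℕ
  w = ways zs

ways-↭ : ∀ {xs ys} → xs ↭ ys → ways xs ≗ ways ys
ways-↭ refl                   t = refl
ways-↭ (prep {xs} {ys} x p)   t = ways-∷-cong x {xs} {ys} (ways-↭ p) t
ways-↭ (swap {xs} {ys} x y p) t = trans (ways-swap x y xs t)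
  (ways-∷-cong y {x ∷ xs} {x ∷ ys} (ways-∷-cong x {xs} {ys} (ways-↭ p)) t)
ways-↭ (↭-trans p q)          t = trans (ways-↭ p t) (ways-↭ q t)

ways-⊆ : ∀ {xs ys} → xs ⊆ ys → ∀ t → ways xs t ≤ ways ys t
ways-⊆ []               t = ≤-refl
ways-⊆ (y ∷ʳ p)         t = ≤-trans (ways-⊆ p t) (m≤m+n _ _)
ways-⊆ (_∷_ {x} refl p) t = +-mono-≤ (ways-⊆ p t) (shift-mono-≤ x (ways-⊆ p) t)

#withSum : List (List ℕ) → ℕ → ℕ
#withSum ss t = length (filterᵇ (λ s → sum s ≡ᵇ t) ss)

length-filterᵇ-++ : ∀ (p : A → Bool) xs ys →
                    length (filterᵇ p (xs ++ ys)) ≡ length (filterᵇ p xs) + length (filterᵇ p ys)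
length-filterᵇ-++ p xs ys = trans (cong length (filter-++ (T? ∘ p) xs ys)) (length-++ (filterᵇ p xs))

length-filterᵇ-map : ∀ (p : B → Bool) (f : A → B) xs →
                     length (filterᵇ p (map f xs)) ≡ length (filterᵇ (p ∘ f) xs)
length-filterᵇ-map p f []       = refl
length-filterᵇ-map p f (x ∷ xs) with p (f x)
... | true  = cong suc (length-filterᵇ-map p f xs)
... | false = length-filterᵇ-map p f xs

#withSum-map-∷ : ∀ x ss t → #withSum (map (x ∷_) ss) t ≡ shift x (#withSum ss) t
#withSum-map-∷ x ss t = trans (length-filterᵇ-map _ (x ∷_) ss) (offset x t)
  where
  offset : ∀ y u → length (filterᵇ (λ s → y + sum s ≡ᵇ u) ss) ≡ shift y (#withSum ss) u
  offset zero    u       = refl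
  offset (suc y) zero    = cong length (filter-none _ (universal (λ _ ()) ss))
  offset (suc y) (suc u) = offset y u

#withSum-subsets : ∀ xs t → #withSum (subsets xs) t ≡ ways xs t
#withSum-subsets []       zero    = refl
#withSum-subsets []       (suc t) = refl
#withSum-subsets (x ∷ xs) t       = begin
  #withSum (subsets xs ++ map (x ∷_) (subsets xs)) t
    ≡⟨ length-filterᵇ-++ _ (subsets xs) _ ⟩
  #withSum (subsets xs) t + #withSum (map (x ∷_) (subsets xs)) t
    ≡⟨ cong (#withSum (subsets xs) t +_) (#withSum-map-∷ x (subsets xs) t) ⟩
  #withSum (subsets xs) t + shift x (#withSum (subsets xs)) t
    ≡⟨ cong₂ _+_ (#withSum-subsets xs t) (shift-cong x (#withSum-subsets xs) t) ⟩
  ways xs t + shift x (ways xs) t ∎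
  where open ≡-Reasoning

powersOfTwo : ℕ → List ℕ
powersOfTwo zero    = []
powersOfTwo (suc k) = 2 ^ k ∷ powersOfTwo k

-- (1 − X) ∏_{j<k} (1 + X^(2^j)) = 1 − X^(2^k), multiplied by the series of R and with the
-- negative terms moved across.
ways-powersOfTwo-++ : ∀ k R u →
  ways (powersOfTwo k ++ R) u + shift (2 ^ k) (ways R) u ≡ shift 1 (ways (powersOfTwo k ++ R)) u + ways R u
ways-powersOfTwo-++ zero    R u = +-comm (ways R u) _
ways-powersOfTwo-++ (suc k) R u = begin
  (c u + shift m c u) + shift (m + (m + 0)) r u
    ≡⟨ cong (c u + shift m c u +_) shift-2m ⟩
  (c u + shift m c u) + shift m (shift m r) u
    ≡⟨ +-assoc (c u) _ _ ⟩
  c u + (shift m c u + shift m (shift m r) u)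
    ≡⟨ cong (c u +_) (shift-distrib-+ m c (shift m r) u) ⟨
  c u + shift m (λ v → c v + shift m r v) u
    ≡⟨ cong (c u +_) (shift-cong m (ways-powersOfTwo-++ k R) u) ⟩
  c u + shift m (λ v → shift 1 c v + r v) u
    ≡⟨ cong (c u +_) (shift-distrib-+ m (shift 1 c) r u) ⟩
  c u + (shift m (shift 1 c) u + shift m r u)
    ≡⟨ x∙yz≈xz∙y (c u) _ _ ⟩
  (c u + shift m r u) + shift m (shift 1 c) u
    ≡⟨ cong₂ _+_ (ways-powersOfTwo-++ k R u) (shift-comm m 1 c u) ⟩
  (shift 1 c u + r u) + shift 1 (shift m c) u
    ≡⟨ xy∙z≈xz∙y (shift 1 c u) _ _ ⟩
  (shift 1 c u + shift 1 (shift m c) u) + r u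
    ≡⟨ cong (_+ r u) (shift-distrib-+ 1 c (shift m c) u) ⟨
  shift 1 (λ v → c v + shift m c v) u + r u ∎
  where
  open ≡-Reasoning
  m : ℕ
  m = 2 ^ k
  c r : ℕ → ℕ
  c = ways (powersOfTwo k ++ R)
  r = ways R
  shift-2m : shift (m + (m + 0)) r u ≡ shift m (shift m r) u
  shift-2m = trans (cong (λ z → shift (m + z) r u) (+-identityʳ m)) (sym (shift-+ m m r u))

ways-powersOfTwo-++-≤-suc : ∀ k R t → suc t < 2 ^ k →
                            ways (powersOfTwo k ++ R) t ≤ ways (powersOfTwo k ++ R) (suc t)
ways-powersOfTwo-++-≤-suc k R t 1+t<2^k = begin
  c t                                        ≤⟨ m≤m+n (c t) (ways R (suc t)) ⟩
  c t + ways R (suc t)                       ≡⟨ ways-powersOfTwo-++ k R (suc t) ⟨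
  c (suc t) + shift (2 ^ k) (ways R) (suc t) ≡⟨ cong (c (suc t) +_) (shift-< (2 ^ k) (ways R) 1+t<2^k) ⟩
  c (suc t) + 0                              ≡⟨ +-identityʳ (c (suc t)) ⟩
  c (suc t)                                  ∎
  where
  open ≤-Reasoning
  c : ℕ → ℕ
  c = ways (powersOfTwo k ++ R)

↭-powersOfTwo-++ : ∀ k {xs} → (∀ j → j < k → 2 ^ j ∈ xs) → ∃[ R ] xs ↭ powersOfTwo k ++ R
↭-powersOfTwo-++ zero    {xs} _   = xs , refl
↭-powersOfTwo-++ (suc k) {xs} 2^j∈xs with ys , zs , refl ← ∈-∃++ (2^j∈xs k ≤-refl) =
  let R , ys++zs↭ = ↭-powersOfTwo-++ k 2^j∈ys++zs
  in  R , ↭-trans (↭-shift (2 ^ k) ys zs) (prep (2 ^ k) ys++zs↭)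
  where
  2^j∈ys++zs : ∀ j → j < k → 2 ^ j ∈ ys ++ zs
  2^j∈ys++zs j j<k with ∈-resp-↭ (↭-shift (2 ^ k) ys zs) (2^j∈xs j (m<n⇒m<1+n j<k))
  ... | here 2^j≡2^k = contradiction 2^j≡2^k (<⇒≢ (^-monoʳ-< 2 (s≤s (s≤s z≤n)) j<k))
  ... | there 2^j∈  = 2^j∈

n<2^n : ∀ n → n < 2 ^ n
n<2^n zero    = s≤s z≤n
n<2^n (suc n) = begin-strict
  suc n            <⟨ s≤s (n<2^n n) ⟩
  1 + 2 ^ n        ≤⟨ +-monoˡ-≤ (2 ^ n) (m^n>0 2 n) ⟩
  2 ^ n + 2 ^ n    ≡⟨ cong (2 ^ n +_) (+-identityʳ (2 ^ n)) ⟨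
  2 ^ suc n        ∎
  where open ≤-Reasoning

powerOfTwo-bracket : ∀ n → ∃[ k ] 2 ^ k ≤ suc n × suc n < 2 ^ suc k
powerOfTwo-bracket zero = 0 , s≤s z≤n , s≤s (s≤s z≤n)
powerOfTwo-bracket (suc n) with k , 2^k≤1+n , 1+n<2^[1+k] ← powerOfTwo-bracket n
  with m≤n⇒m<n∨m≡n 1+n<2^[1+k]
... | inj₁ 2+n<2^[1+k] = k , m≤n⇒m≤1+n 2^k≤1+n , 2+n<2^[1+k]
... | inj₂ 2+n≡2^[1+k] = suc k , ≤-reflexive (sym 2+n≡2^[1+k]) ,
  subst (_< 2 ^ suc (suc k)) (sym 2+n≡2^[1+k]) (^-monoʳ-< 2 (s≤s (s≤s z≤n)) (n<1+n (suc k)))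

upTo-⊆-suc : ∀ n → upTo n ⊆ upTo (suc n)
upTo-⊆-suc n = subst (upTo n ⊆_) (upTo-∷ʳ n) (++⁺ʳ [ n ] ⊆-refl)

isTermᵇ-mono : ∀ q n m → T (isTermᵇ q n m) → T (isTermᵇ q (suc n) m)
isTermᵇ-mono q n m = widen ∘ Any.map (widen ∘ any⁻ _ _) ∘ any⁻ _ _
  where
  widen : ∀ {p} → Any (T ∘ p) (upTo (suc n)) → T (any p (upTo (suc (suc n))))
  widen = any⁺ _ ∘ Any-resp-⊆ (upTo-⊆-suc (suc n))

isTermᵇ-powerOfTwo : ∀ q n j → j ≤ n → T (isTermᵇ q n (2 ^ j))
isTermᵇ-powerOfTwo q n j j≤n =
  any⁺ _ (lose (∈-upTo⁺ (s≤s j≤n))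
    (any⁺ (λ b → 2 ^ j * q ^ b ≡ᵇ 2 ^ j) (lose (∈-upTo⁺ {suc n} (s≤s z≤n)) 2^j*q^0≡ᵇ2^j)))
  where
  2^j*q^0≡ᵇ2^j : T (2 ^ j * q ^ 0 ≡ᵇ 2 ^ j)
  2^j*q^0≡ᵇ2^j = ≡⇒≡ᵇ _ _ (*-identityʳ (2 ^ j))

termsUpTo-⊆-suc : ∀ q n → termsUpTo q n ⊆ termsUpTo q (suc n)
termsUpTo-⊆-suc q n = filter⁺ (T? ∘ isTermᵇ q n) (T? ∘ isTermᵇ q (suc n))
  (λ { refl → isTermᵇ-mono q n _ }) (map⁺ suc (upTo-⊆-suc n))

powersOfTwo-∈-termsUpTo : ∀ q n k → 2 ^ k ≤ n → ∀ j → j < suc k → 2 ^ j ∈ termsUpTo q n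
powersOfTwo-∈-termsUpTo q n k 2^k≤n j (s≤s j≤k) = ∈-filter⁺ (T? ∘ isTermᵇ q n)
  (positive-∈ (m^n>0 2 j) 2^j≤n) (isTermᵇ-powerOfTwo q n j (<⇒≤ (<-≤-trans (n<2^n j) 2^j≤n)))
  where
  2^j≤n : 2 ^ j ≤ n
  2^j≤n = ≤-trans (^-monoʳ-≤ 2 j≤k) 2^k≤n
  positive-∈ : ∀ {m} → 0 < m → m ≤ n → m ∈ map suc (upTo n)
  positive-∈ {suc m} _ m<n = ∈-map⁺ suc (∈-upTo⁺ m<n)

corollary4 : (q : ℕ) → ¬ (2 ∣ q) → 2 < q → (n : ℕ) → 1 ≤ n → f₂ q n ≤ f₂ q (suc n)
corollary4 q _ _ n _
  with k , 2^k≤1+n , 1+n<2^[1+k] ← powerOfTwo-bracket n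
  with R , terms↭ ← ↭-powersOfTwo-++ (suc k) (powersOfTwo-∈-termsUpTo q (suc n) k 2^k≤1+n)
  = begin
  f₂ q n                                  ≡⟨ #withSum-subsets (termsUpTo q n) n ⟩
  ways (termsUpTo q n) n                  ≤⟨ ways-⊆ (termsUpTo-⊆-suc q n) n ⟩
  ways (termsUpTo q (suc n)) n            ≡⟨ ways-↭ terms↭ n ⟩
  ways (powersOfTwo (suc k) ++ R) n       ≤⟨ ways-powersOfTwo-++-≤-suc (suc k) R n 1+n<2^[1+k] ⟩
  ways (powersOfTwo (suc k) ++ R) (suc n) ≡⟨ ways-↭ terms↭ (suc n) ⟨
  ways (termsUpTo q (suc n)) (suc n)      ≡⟨ #withSum-subsets (termsUpTo q (suc n)) (suc n) ⟨
  f₂ q (suc n)                            ∎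
  where open ≤-Reasoning
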